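{- Consider an instance of the lower bounded facility location problem (in particular, of the min-sum $r$-gathering problem) on a weighted tree. If the instance has an optimal solution, then it has an optimal solution with the following property: for every edge $e$ of the tree, all users whose path to their assigned facility traverses $e$ traverse $e$ in the same direction.
   Context: A weighted tree has non-negative edge lengths and tree metric $d$ (sum of edge lengths along the unique path). In the lower bounded facility location problem on a tree, we are given a positive integer $r$, a finite multiset $\mathcal{U}$ of users and a finite set $\mathcal{F}$ of facilities located at vertices, and an opening cost $c(f)\ge 0$ for each facility $f$. A feasible solution opens some facilities and assigns every user to an open facility so that each open facility receives at least $r$ users. Its cost is $\sum_{u\in\mathcal{U}} d(u,f(u))+\sum_{f\text{ open}} c(f)$, where $f(u)$ is the facility assigned to $u$; the goal is to minimize it. The min-sum $r$-gathering problem is the special case with all opening costs equal to $0$.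
   Formalization: The edge lengths and the opening costs are non-negative rationals rather than non-negative reals. -}

module Defs where

open import Data.Nat using (ℕ; zero; suc)
import Data.Nat as ℕ
open import Data.Fin using (Fin; zero; suc; toℕ; _≟_)
open import Data.Bool using (Bool; true; false; T; _xor_; _∧_; not; if_then_else_)
open import Data.List using (List; map; foldr; filter; length; allFin)
open import Data.Rational using (ℚ; 0ℚ; _+_; _≤_)
open import Data.Product using (Σ; _×_; ∃)
open import Relation.Nullary using (¬_; does)

-- A tree with vertex set Fin (suc n) is given by a parent array: the
-- vertex (suc i) has parent (parent i), whose index is at most i
-- (vertex 0 is the root).  Every finite tree admits such a labelling.
-- Edge i (for i : Fin n) is the edge {suc i , parent i}; its length
-- is len i ≥ 0.

record WTree (n : ℕ) : Set where
  field
    parent   : Fin n → Fin (suc n)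
    parent<  : ∀ i → toℕ (parent i) ℕ.≤ toℕ i
    len      : Fin n → ℚ
    len≥0    : ∀ i → 0ℚ ≤ len i
open WTree public

Vertex : ℕ → Set
Vertex n = Fin (suc n)

-- `below T e v` : vertex v lies in the subtree hanging below edge e,
-- i.e. in the subtree rooted at the child endpoint (suc e).
-- (Walks up the parent chain; fuel suc n suffices since indices strictly
-- decrease.)
belowFuel : ∀ {n} → WTree n → ℕ → Fin n → Vertex n → Bool
belowFuel T zero    e v       = false
belowFuel T (suc k) e v with does (v ≟ suc e)
... | true  = true
... | false with v
...   | zero  = false
...   | suc i = belowFuel T k e (parent T i)

below : ∀ {n} → WTree n → Fin n → Vertex n → Bool
below {n} T e v = belowFuel T (suc n) e v

-- edge e lies on the unique u–v path iff it separates u from v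
onPath : ∀ {n} → WTree n → Fin n → Vertex n → Vertex n → Bool
onPath T e u v = below T e u xor below T e v

sumℚ : List ℚ → ℚ
sumℚ = foldr _+_ 0ℚ

dist : ∀ {n} → WTree n → Vertex n → Vertex n → ℚ
dist {n} T u v =
  sumℚ (map (λ e → if onPath T e u v then len T e else 0ℚ) (allFin n))

up : ∀ {n} → WTree n → Fin n → Vertex n → Vertex n → Bool
up T e u v = below T e u ∧ not (below T e v)

down : ∀ {n} → WTree n → Fin n → Vertex n → Vertex n → Bool
down T e u v = not (below T e u) ∧ below T e v

-- Lower bounded facility location on a tree.
-- m users (a multiset, given as a family user : Fin m → Vertex n),
-- k facilities located at vertices, with opening costs ≥ 0.

record Instance (n m k : ℕ) : Set where
  field
    tree   : WTree n
    r      : ℕ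
    r≥1    : 1 ℕ.≤ r
    user   : Fin m → Vertex n
    loc    : Fin k → Vertex n
    cost   : Fin k → ℚ
    cost≥0 : ∀ f → 0ℚ ≤ cost f
open Instance public

record Solution (m k : ℕ) : Set where
  field
    opened : Fin k → Bool
    assign : Fin m → Fin k
open Solution public

load : ∀ {m k} → Solution m k → Fin k → ℕ
load {m} S f = length (filter (λ u → assign S u ≟ f) (allFin m))

Feasible : ∀ {n m k} → Instance n m k → Solution m k → Set
Feasible I S =
  (∀ u → T (opened S (assign S u))) ×
  (∀ f → T (opened S f) → r I ℕ.≤ load S f)

totalCost : ∀ {n m k} → Instance n m k → Solution m k → ℚ
totalCost {n} {m} {k} I S =
  sumℚ (map (λ u → dist (tree I) (user I u) (loc I (assign S u))) (allFin m))
  + sumℚ (map (λ f → if opened S f then cost I f else 0ℚ) (allFin k))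

Optimal : ∀ {n m k} → Instance n m k → Solution m k → Set
Optimal I S = Feasible I S × (∀ S′ → Feasible I S′ → totalCost I S ≤ totalCost I S′)

Unidirectional : ∀ {n m k} → Instance n m k → Solution m k → Set
Unidirectional {n} {m} I S =
  ∀ (e : Fin n) (u u′ : Fin m) →
    T (up (tree I) e (user I u) (loc I (assign S u))) →
    T (down (tree I) e (user I u′) (loc I (assign S u′))) → ⊥′
  where open import Data.Empty using () renaming (⊥ to ⊥′)

{-# OPTIONS --safe #-}
module Submission where

-- Suppose the path from user x to its facility F crosses an edge e upward while the path
-- from user y to its facility F′ crosses e downward.  Swapping the two facilities leaves
-- every load unchanged.  The subtrees hanging below the edges form a laminar family, so
-- no edge has x, F on one side and y, F′ on the other; hence every edge is used by the
-- new paths x–F′, y–F at most as often as by the old paths x–F, y–F′, and e itself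
-- drops from two uses to none.  The cost therefore does not increase (edge lengths are
-- non-negative) while the total number of edge traversals strictly decreases, so
-- repeated swapping turns an optimal solution into an optimal unidirectional one.

open import Defs

open import Algebra.Bundles using (CommutativeMonoid)
import Algebra.Properties.CommutativeMonoid.Sum as CommutativeMonoidSum
open import Data.Bool using (Bool; true; false; T; _xor_; if_then_else_)
open import Data.Bool.Properties using (T-∧; T-≡; T-not-≡)
open import Data.Fin using (Fin; zero; suc; toℕ; _≟_; punchIn; punchOut)
import Data.Fin.Induction as Fin
open import Data.Fin.Permutation using (Permutation′; _⟨$⟩ʳ_; transpose)
import Data.Fin.Permutation.Components as PC
open import Data.Fin.Properties
  using (any?; suc-injective; toℕ<n; punchIn-punchOut; punchInᵢ≢i; punchIn-injective)
open import Data.List using (map; foldr; filter; length; tabulate; allFin)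
open import Data.List.Properties using (map-tabulate)
open import Data.Nat using (ℕ; zero; suc; s≤s; z≤n; _+_; _<_; _≤_)
open import Data.Nat.Induction using (<-wellFounded)
import Data.Nat.Properties as ℕ
open import Data.Product using (Σ; _×_; _,_; proj₁; ∃; ∃₂)
import Data.Product as Product
open import Data.Rational using (ℚ; 0ℚ)
import Data.Rational as ℚ using (_+_; _≤_)
import Data.Rational.Properties as ℚᵖ
open import Data.Sum using (_⊎_; inj₁; inj₂)
open import Data.Vec.Functional as Vector using (Vector)
open import Function using (id; _∘_; case_of_; Equivalence)
open import Induction.WellFounded using (Acc; acc)
open import Level using (Level)
open import Relation.Binary using (Rel; Preorder; IsPreorder; _Preserves₂_⟶_⟶_)
open import Relation.Binary.PropositionalEquality
open import Relation.Nullary using (Dec; does; yes; no; contradiction)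
open import Relation.Nullary.Decidable using (_×-dec_; T?; dec-true; dec-false)
open import Relation.Unary using (Pred; Decidable; _⊆_)

private
  variable
    a b p : Level
    A B : Set a

  clash : ∀ {x} → x ≡ true → x ≡ false → A
  clash refl ()

foldr-tabulate : (_∙_ : A → B → B) (z : B) {n : ℕ} (f : Fin n → A) →
                 foldr _∙_ z (tabulate f) ≡ Vector.foldr _∙_ z f
foldr-tabulate _∙_ z {zero}  f = refl
foldr-tabulate _∙_ z {suc n} f = cong (f zero ∙_) (foldr-tabulate _∙_ z (f ∘ suc))

foldr-map-allFin : (_∙_ : A → B → B) (z : B) {n : ℕ} (f : Fin n → A) →
                   foldr _∙_ z (map f (allFin n)) ≡ Vector.foldr _∙_ z f
foldr-map-allFin _∙_ z f = trans (cong (foldr _∙_ z) (map-tabulate id f)) (foldr-tabulate _∙_ z f)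

transpose-matchˡ : ∀ {n} (i j : Fin n) → PC.transpose i j i ≡ j
transpose-matchˡ i j rewrite dec-true (i ≟ i) refl = refl

transpose-matchʳ : ∀ {n} (i j : Fin n) → PC.transpose i j j ≡ i
transpose-matchʳ i j with j ≟ i
... | yes refl = refl
... | no _ rewrite dec-true (j ≟ j) refl = refl

transpose-other : ∀ {n} {i j k : Fin n} → k ≢ i → k ≢ j → PC.transpose i j k ≡ k
transpose-other {i = i} {j} {k} k≢i k≢j rewrite dec-false (k ≟ i) k≢i | dec-false (k ≟ j) k≢j = refl

module _ {n : ℕ} (tr : WTree n) where

  Subtree : Fin n → Pred (Vertex n) Level.zero
  Subtree e v = below tr e v ≡ true

  belowFuel-enough : ∀ {k k′} e v → toℕ v < k → toℕ v < k′ →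
                     belowFuel tr k e v ≡ belowFuel tr k′ e v
  belowFuel-enough {suc k} {suc k′} e zero    _         _          = refl
  belowFuel-enough {suc k} {suc k′} e (suc i) (s≤s i<k) (s≤s i<k′) with does (suc i ≟ suc e)
  ... | true  = refl
  ... | false = belowFuel-enough e (parent tr i)
                  (ℕ.≤-<-trans (parent< tr i) i<k) (ℕ.≤-<-trans (parent< tr i) i<k′)

  below-self : ∀ e → Subtree e (suc e)
  below-self e rewrite dec-true (suc e ≟ suc e) refl = refl

  below-step : ∀ {e i} → i ≢ e → below tr e (suc i) ≡ below tr e (parent tr i)
  below-step {e} {i} i≢e rewrite dec-false (suc i ≟ suc e) (i≢e ∘ suc-injective) =
    belowFuel-enough e (parent tr i) parent<n (ℕ.m<n⇒m<1+n parent<n)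
    where parent<n = ℕ.≤-<-trans (parent< tr i) (toℕ<n i)

  vertex-ind : ∀ {ℓ} (P : Vertex n → Set ℓ) → P zero → (∀ i → P (parent tr i) → P (suc i)) → ∀ v → P v
  vertex-ind P P-root P-step v = go v (Fin.<-wellFounded v)
    where
    go : ∀ v → Acc Data.Fin._<_ v → P v
    go zero    _        = P-root
    go (suc i) (acc rs) = P-step i (go (parent tr i) (rs (s≤s (parent< tr i))))

  below-parent : ∀ e i → Subtree e (parent tr i) → Subtree e (suc i)
  below-parent e i p∈e = case i ≟ e of λ where
    (yes refl) → below-self e
    (no i≢e)   → trans (below-step i≢e) p∈e

  below-⊆ : ∀ {e e′} → Subtree e′ (suc e) → Subtree e ⊆ Subtree e′
  below-⊆ {e} {e′} e∈e′ {v} = vertex-ind (λ v → Subtree e v → Subtree e′ v) (λ ()) step v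
    where
    step : ∀ i → (Subtree e (parent tr i) → Subtree e′ (parent tr i)) → Subtree e (suc i) → Subtree e′ (suc i)
    step i ih i∈e = case i ≟ e of λ where
      (yes refl) → e∈e′
      (no i≢e)   → below-parent e′ i (ih (trans (sym (below-step i≢e)) i∈e))

  below-common : ∀ {e e′} v → Subtree e v → Subtree e′ v → Subtree e′ (suc e) ⊎ Subtree e (suc e′)
  below-common {e} {e′} = vertex-ind (λ v → Subtree e v → Subtree e′ v → Goal) (λ ()) step
    where
    Goal = Subtree e′ (suc e) ⊎ Subtree e (suc e′)
    step : ∀ i → (Subtree e (parent tr i) → Subtree e′ (parent tr i) → Goal) →
           Subtree e (suc i) → Subtree e′ (suc i) → Goal
    step i ih i∈e i∈e′ = case ((i ≟ e) , (i ≟ e′)) of λ where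
      (yes refl , _)        → inj₁ i∈e′
      (no _     , yes refl) → inj₂ i∈e
      (no i≢e   , no i≢e′)  → ih (trans (sym (below-step i≢e)) i∈e) (trans (sym (below-step i≢e′)) i∈e′)

  below-nested : ∀ {e e′ v} → Subtree e v → Subtree e′ v → Subtree e ⊆ Subtree e′ ⊎ Subtree e′ ⊆ Subtree e
  below-nested {e} {e′} {v} v∈e v∈e′ with below-common v v∈e v∈e′
  ... | inj₁ e∈e′ = inj₁ λ {w} → below-⊆ e∈e′ {w}
  ... | inj₂ e′∈e = inj₂ λ {w} → below-⊆ e′∈e {w}

  up-below : ∀ {e x F} → T (up tr e x F) → below tr e x ≡ true × below tr e F ≡ false
  up-below = Product.map (Equivalence.to T-≡) (Equivalence.to T-not-≡) ∘ Equivalence.to T-∧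

  down-below : ∀ {e y F′} → T (down tr e y F′) → below tr e y ≡ false × below tr e F′ ≡ true
  down-below = Product.map (Equivalence.to T-not-≡) (Equivalence.to T-≡) ∘ Equivalence.to T-∧

  record OppositeCrossings (e : Fin n) (x F y F′ : Vertex n) : Set where
    constructor opposite
    field
      upward   : T (up tr e x F)
      downward : T (down tr e y F′)

  crossing-sides : ∀ {e x F y F′} → OppositeCrossings e x F y F′ →
                   Subtree e x × below tr e F ≡ false × below tr e y ≡ false × Subtree e F′
  crossing-sides {e} {x} {F} {y} {F′} (opposite x↑F y↓F′)
    with up-below {e} {x} {F} x↑F | down-below {e} {y} {F′} y↓F′
  ... | x∈e , F∉e | y∉e , F′∈e = x∈e , F∉e , y∉e , F′∈e

  NoEdgeSeparates : Vertex n → Vertex n → Vertex n → Vertex n → Set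
  NoEdgeSeparates x F y F′ =
    ∀ e → below tr e x ≡ below tr e F → below tr e y ≡ below tr e F′ → below tr e x ≡ below tr e y

  opposite-crossings-unseparated : ∀ {e x F y F′} → OppositeCrossings e x F y F′ → NoEdgeSeparates x F y F′
  -- The with-abstraction also rewrites x∼F and y∼F′, e.g. to true ≡ below tr e′ F.
  opposite-crossings-unseparated {e} {x} {F} {y} {F′} crossed e′ x∼F y∼F′
    with crossing-sides crossed | below tr e′ x in x?e′ | below tr e′ y in y?e′
  ... | _ | true  | true  = refl
  ... | _ | false | false = refl
  ... | x∈e , F∉e , _ , F′∈e | true | false with below-nested {e} {e′} {x} x∈e x?e′
  ...   | inj₁ e⊆e′ = clash (e⊆e′ {F′} F′∈e) (sym y∼F′)
  ...   | inj₂ e′⊆e = clash (e′⊆e {F} (sym x∼F)) F∉e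
  opposite-crossings-unseparated {e} {x} {F} {y} {F′} crossed e′ x∼F y∼F′
    | x∈e , _ , y∉e , F′∈e | false | true with below-nested {e} {e′} {F′} F′∈e (sym y∼F′)
  ...   | inj₁ e⊆e′ = clash (e⊆e′ {x} x∈e) x?e′
  ...   | inj₂ e′⊆e = clash (e′⊆e {y} y?e′) y∉e

module MonoidSums {c ℓ} (M : CommutativeMonoid c ℓ) where

  open CommutativeMonoid M
    using (Carrier; _≈_; _∙_; ε; ∙-congˡ; assoc)
    renaming (sym to ≈-sym)
  open CommutativeMonoidSum M public
  open import Relation.Binary.Reasoning.Setoid (CommutativeMonoid.setoid M)

  infixr 8 [_]*_
  [_]*_ : Bool → Carrier → Carrier
  [ b ]* x = if b then x else ε

  pathWeight : ∀ {n} → WTree n → (Fin n → Carrier) → Vertex n → Vertex n → Carrier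
  pathWeight tr w a b = sum (λ e → [ onPath tr e a b ]* w e)

  sum-remove₂ : ∀ {n} (f : Vector Carrier (suc (suc n))) i j →
                sum f ≈ (f i ∙ f (punchIn i j)) ∙ sum (Vector.removeAt (Vector.removeAt f i) j)
  sum-remove₂ f i j = begin
    sum f                                 ≈⟨ sum-remove {i = i} f ⟩
    f i ∙ sum (Vector.removeAt f i)       ≈⟨ ∙-congˡ (sum-remove {i = j} (Vector.removeAt f i)) ⟩
    f i ∙ (f (punchIn i j) ∙ sum rest)    ≈⟨ assoc _ _ _ ⟨
    (f i ∙ f (punchIn i j)) ∙ sum rest    ∎
    where rest = Vector.removeAt (Vector.removeAt f i) j

  sum-split-outside₂ : ∀ {n} {f g : Vector Carrier n} {u u′} → u ≢ u′ →
                       (∀ w → w ≢ u → w ≢ u′ → f w ≈ g w) →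
             ∃ λ r → sum f ≈ (f u ∙ f u′) ∙ r × sum g ≈ (g u ∙ g u′) ∙ r
  sum-split-outside₂ {suc zero} {u = zero} {zero} u≢u′ _ = contradiction refl u≢u′
  sum-split-outside₂ {suc (suc n)} {f} {g} {u} {u′} u≢u′ f≈g with punchOut u≢u′ | punchIn-punchOut u≢u′
  ... | j | refl = sum (rest f) , sum-remove₂ f u j , (begin
    sum g                                  ≈⟨ sum-remove₂ g u j ⟩
    (g u ∙ g (punchIn u j)) ∙ sum (rest g) ≈⟨ ∙-congˡ (sum-cong-≋ rest-g≈rest-f) ⟩
    (g u ∙ g (punchIn u j)) ∙ sum (rest f) ∎)
    where
    rest : Vector Carrier (suc (suc n)) → Vector Carrier n
    rest h = Vector.removeAt (Vector.removeAt h u) j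
    rest-g≈rest-f : ∀ k → rest g k ≈ rest f k
    rest-g≈rest-f k = ≈-sym (f≈g _ (punchInᵢ≢i u _) (punchInᵢ≢i j k ∘ punchIn-injective u _ _))

module OrderedSums {c ℓ ℓ′} (M : CommutativeMonoid c ℓ) {_≤_ : Rel (CommutativeMonoid.Carrier M) ℓ′}
  (≤-isPreorder : IsPreorder (CommutativeMonoid._≈_ M) _≤_)
  (∙-mono-≤ : CommutativeMonoid._∙_ M Preserves₂ _≤_ ⟶ _≤_ ⟶ _≤_) where

  open MonoidSums M public
  open CommutativeMonoid M using (Carrier; _∙_; ε; comm) renaming (reflexive to ≈-reflexive)
  open IsPreorder ≤-isPreorder using (reflexive) renaming (refl to ≤-refl)

  ≤-preorder : Preorder c ℓ ℓ′
  ≤-preorder = record { isPreorder = ≤-isPreorder }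

  open import Relation.Binary.Reasoning.Preorder ≤-preorder

  sum-mono-≤ : ∀ {n} {f g : Vector Carrier n} → (∀ i → f i ≤ g i) → sum f ≤ sum g
  sum-mono-≤ {zero}  f≤g = ≤-refl
  sum-mono-≤ {suc n} f≤g = ∙-mono-≤ (f≤g zero) (sum-mono-≤ (f≤g ∘ suc))

  sum-transpose-≤ : ∀ {n} (c : Fin n → Fin n → Carrier) {u u′} → u ≢ u′ →
                    (c u u′ ∙ c u′ u) ≤ (c u u ∙ c u′ u′) →
                    sum (λ w → c w (PC.transpose u u′ w)) ≤ sum (λ w → c w w)
  sum-transpose-≤ c {u} {u′} u≢u′ swap≤
    with sum-split-outside₂ u≢u′ (λ w w≢u w≢u′ → ≈-reflexive (cong (c w) (transpose-other w≢u w≢u′)))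
  ... | r , swapped≈ , unswapped≈ = begin
    sum (λ w → c w (PC.transpose u u′ w))                            ≈⟨ swapped≈ ⟩
    (c u (PC.transpose u u′ u) ∙ c u′ (PC.transpose u u′ u′)) ∙ r  ≡⟨ cong₂ (λ s t → (c u s ∙ c u′ t) ∙ r)
                                                                         (transpose-matchˡ u u′) (transpose-matchʳ u u′) ⟩
    (c u u′ ∙ c u′ u) ∙ r                                            ≲⟨ ∙-mono-≤ swap≤ ≤-refl ⟩
    (c u u ∙ c u′ u′) ∙ r                                            ≈⟨ unswapped≈ ⟨
    sum (λ w → c w w)                                                ∎

  []*-uncross : ∀ {x} → ε ≤ x → ∀ a b c d → (a ≡ b → c ≡ d → a ≡ c) →
                ([ a xor d ]* x ∙ [ c xor b ]* x) ≤ ([ a xor b ]* x ∙ [ c xor d ]* x)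
  []*-uncross x≥0 false false false false _ = ≤-refl
  []*-uncross x≥0 false false false true  _ = reflexive (comm _ _)
  []*-uncross x≥0 false false true  false _ = ≤-refl
  []*-uncross x≥0 false false true  true  unseparated with () ← unseparated refl refl
  []*-uncross x≥0 false true  false false _ = reflexive (comm _ _)
  []*-uncross x≥0 false true  false true  _ = ≤-refl
  []*-uncross x≥0 false true  true  false _ = ∙-mono-≤ x≥0 x≥0
  []*-uncross x≥0 false true  true  true  _ = ≤-refl
  []*-uncross x≥0 true  false false false _ = ≤-refl
  []*-uncross x≥0 true  false false true  _ = ∙-mono-≤ x≥0 x≥0
  []*-uncross x≥0 true  false true  false _ = ≤-refl
  []*-uncross x≥0 true  false true  true  _ = reflexive (comm _ _)
  []*-uncross x≥0 true  true  false false unseparated with () ← unseparated refl refl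
  []*-uncross x≥0 true  true  false true  _ = ≤-refl
  []*-uncross x≥0 true  true  true  false _ = reflexive (comm _ _)
  []*-uncross x≥0 true  true  true  true  _ = ≤-refl

  pathWeight-uncross : ∀ {n} (tr : WTree n) {w : Fin n → Carrier} → (∀ e → ε ≤ w e) →
                       ∀ {x F y F′} → NoEdgeSeparates tr x F y F′ →
                       (pathWeight tr w x F′ ∙ pathWeight tr w y F) ≤ (pathWeight tr w x F ∙ pathWeight tr w y F′)
  pathWeight-uncross tr {w} w≥0 {x} {F} {y} {F′} unseparated = begin
    pathWeight tr w x F′ ∙ pathWeight tr w y F  ≈⟨ ∑-distrib-+ (weight x F′) (weight y F) ⟨
    sum (λ e → weight x F′ e ∙ weight y F e)     ≲⟨ sum-mono-≤ (λ e → []*-uncross (w≥0 e) _ _ _ _ (unseparated e)) ⟩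
    sum (λ e → weight x F e ∙ weight y F′ e)     ≈⟨ ∑-distrib-+ (weight x F) (weight y F′) ⟩
    pathWeight tr w x F ∙ pathWeight tr w y F′  ∎
    where
    weight : Vertex _ → Vertex _ → Fin _ → Carrier
    weight a b e = [ onPath tr e a b ]* w e

module ℚΣ = OrderedSums ℚᵖ.+-0-commutativeMonoid ℚᵖ.≤-isPreorder ℚᵖ.+-mono-≤
module ℕΣ = OrderedSums ℕ.+-0-commutativeMonoid ℕ.≤-isPreorder ℕ.+-mono-≤
open ℕΣ using (sum; sum-remove; sum-mono-≤; [_]*_)

sum-mono-< : ∀ {n} {f g : Vector ℕ n} j → (∀ i → f i ≤ g i) → f j < g j → sum f < sum g
sum-mono-< {suc n} {f} {g} j f≤g fj<gj = begin-strict
  sum f                               ≡⟨ sum-remove {i = j} f ⟩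
  f j + sum (Vector.removeAt f j)     <⟨ ℕ.+-mono-<-≤ fj<gj (sum-mono-≤ (f≤g ∘ punchIn j)) ⟩
  g j + sum (Vector.removeAt g j)     ≡⟨ sum-remove {i = j} g ⟨
  sum g                               ∎
  where open ℕ.≤-Reasoning

sum-transpose-< : ∀ {n} (c : Fin n → Fin n → ℕ) {u u′} → u ≢ u′ →
                  c u u′ + c u′ u < c u u + c u′ u′ →
                  sum (λ w → c w (PC.transpose u u′ w)) < sum (λ w → c w w)
sum-transpose-< c {u} {u′} u≢u′ swap<
  with ℕΣ.sum-split-outside₂ u≢u′ (λ w w≢u w≢u′ → cong (c w) (transpose-other w≢u w≢u′))
... | r , swapped≡ , unswapped≡ = begin-strict
  sum (λ w → c w (PC.transpose u u′ w))                            ≡⟨ swapped≡ ⟩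
  (c u (PC.transpose u u′ u) + c u′ (PC.transpose u u′ u′)) + r  ≡⟨ cong₂ (λ s t → (c u s + c u′ t) + r)
                                                                       (transpose-matchˡ u u′) (transpose-matchʳ u u′) ⟩
  (c u u′ + c u′ u) + r                                            <⟨ ℕ.+-monoˡ-< r swap< ⟩
  (c u u + c u′ u′) + r                                            ≡⟨ unswapped≡ ⟨
  sum (λ w → c w w)                                                ∎
  where open ℕ.≤-Reasoning

hops : ∀ {n} → WTree n → Vertex n → Vertex n → ℕ
hops tr = ℕΣ.pathWeight tr (λ _ → 1)

hops-uncross : ∀ {n} (tr : WTree n) {e x F y F′} → OppositeCrossings tr e x F y F′ →
               hops tr x F′ + hops tr y F < hops tr x F + hops tr y F′
hops-uncross tr {e} {x} {F} {y} {F′} crossed = begin-strict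
  hops tr x F′ + hops tr y F  ≡⟨ ℕΣ.∑-distrib-+ (hop x F′) (hop y F) ⟨
  sum after                   <⟨ sum-mono-< {f = after} {before} e after≤before at-e ⟩
  sum before                  ≡⟨ ℕΣ.∑-distrib-+ (hop x F) (hop y F′) ⟩
  hops tr x F + hops tr y F′  ∎
  where
  open ℕ.≤-Reasoning
  hop : Vertex _ → Vertex _ → Fin _ → ℕ
  hop a b e = [ onPath tr e a b ]* 1
  after before : Fin _ → ℕ
  after  e′ = hop x F′ e′ + hop y F e′
  before e′ = hop x F e′ + hop y F′ e′
  after≤before : ∀ e′ → after e′ ≤ before e′
  after≤before e′ = ℕΣ.[]*-uncross z≤n _ _ _ _ (opposite-crossings-unseparated tr crossed e′)
  at-e : after e < before e
  at-e with crossing-sides tr crossed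
  ... | x∈e , F∉e , y∉e , F′∈e rewrite x∈e | F∉e | y∉e | F′∈e = s≤s z≤n

sumℚ-allFin : ∀ {n} (f : Fin n → ℚ) → sumℚ (map f (allFin n)) ≡ ℚΣ.sum f
sumℚ-allFin = foldr-map-allFin ℚ._+_ 0ℚ

dist-pathWeight : ∀ {n} (tr : WTree n) a b → dist tr a b ≡ ℚΣ.pathWeight tr (len tr) a b
dist-pathWeight tr a b = sumℚ-allFin (λ e → ℚΣ.[ onPath tr e a b ]* len tr e)

dist-uncross : ∀ {n} (tr : WTree n) {e x F y F′} → OppositeCrossings tr e x F y F′ →
               dist tr x F′ ℚ.+ dist tr y F ℚ.≤ dist tr x F ℚ.+ dist tr y F′
dist-uncross tr {e} {x} {F} {y} {F′} crossed = begin
  dist tr x F′ ℚ.+ dist tr y F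
    ≡⟨ cong₂ ℚ._+_ (dist-pathWeight tr x F′) (dist-pathWeight tr y F) ⟩
  pathWeight tr (len tr) x F′ ℚ.+ pathWeight tr (len tr) y F
    ≤⟨ ℚΣ.pathWeight-uncross tr (len≥0 tr) {x} {F} {y} {F′} (opposite-crossings-unseparated tr crossed) ⟩
  pathWeight tr (len tr) x F ℚ.+ pathWeight tr (len tr) y F′
    ≡⟨ cong₂ ℚ._+_ (dist-pathWeight tr x F) (dist-pathWeight tr y F′) ⟨
  dist tr x F ℚ.+ dist tr y F′
    ∎
  where
  open ℚᵖ.≤-Reasoning
  open ℚΣ using (pathWeight)

length-filter-tabulate : ∀ {n} {P : Pred A p} (P? : Decidable P) (g : Fin n → A) →
                         length (filter P? (tabulate g)) ≡ sum (λ i → [ does (P? (g i)) ]* 1)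
length-filter-tabulate {n = zero}  P? g = refl
length-filter-tabulate {n = suc n} P? g with does (P? (g zero))
... | true  = cong suc (length-filter-tabulate P? (g ∘ suc))
... | false = length-filter-tabulate P? (g ∘ suc)

load-permute : ∀ {m k} (S : Solution m k) (π : Permutation′ m) f →
               load (record S { assign = assign S ∘ (π ⟨$⟩ʳ_) }) f ≡ load S f
load-permute S π f = begin
  load (record S { assign = assign S ∘ (π ⟨$⟩ʳ_) }) f
    ≡⟨ length-filter-tabulate (λ w → assign S (π ⟨$⟩ʳ w) ≟ f) id ⟩
  sum (λ w → [ does (assign S (π ⟨$⟩ʳ w) ≟ f) ]* 1)
    ≡⟨ ℕΣ.∑-permute (λ w → [ does (assign S w ≟ f) ]* 1) π ⟨
  sum (λ w → [ does (assign S w ≟ f) ]* 1)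
    ≡⟨ length-filter-tabulate (λ w → assign S w ≟ f) id ⟨
  load S f
    ∎
  where open ≡-Reasoning

module _ {n m k} (I : Instance n m k) where

  totalHops : Solution m k → ℕ
  totalHops S = sum (λ u → hops (tree I) (user I u) (loc I (assign S u)))

  Crossing : Solution m k → Set
  Crossing S = ∃ λ e → ∃₂ λ u u′ →
    T (up (tree I) e (user I u) (loc I (assign S u))) × T (down (tree I) e (user I u′) (loc I (assign S u′)))

  crossing? : ∀ S → Dec (Crossing S)
  crossing? S = any? λ e → any? λ u → any? λ u′ → T? _ ×-dec T? _

  optimal-≤ : ∀ {S S′} → Optimal I S → Feasible I S′ → totalCost I S′ ℚ.≤ totalCost I S → Optimal I S′
  optimal-≤ (_ , S-min) S′-feasible S′≤S =
    S′-feasible , λ S″ S″-feasible → ℚᵖ.≤-trans S′≤S (S-min S″ S″-feasible)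

  module _ (S : Solution m k) {e u u′}
           (crossed : OppositeCrossings (tree I) e (user I u) (loc I (assign S u)) (user I u′) (loc I (assign S u′)))
           where

    uncrossed : Solution m k
    uncrossed = record S { assign = assign S ∘ PC.transpose u u′ }

    crossing-users-distinct : u ≢ u′
    crossing-users-distinct refl with crossing-sides (tree I) crossed
    ... | x∈e , _ , y∉e , _ = clash x∈e y∉e

    uncrossed-feasible : Feasible I S → Feasible I uncrossed
    uncrossed-feasible (assigned-open , load≥r) =
      assigned-open ∘ PC.transpose u u′ ,
      λ f f-open → subst (r I ≤_) (sym (load-permute S (transpose u u′) f)) (load≥r f f-open)

    uncrossed-cost : totalCost I uncrossed ℚ.≤ totalCost I S
    uncrossed-cost = ℚᵖ.+-monoˡ-≤ _ (begin
      sumℚ (map (λ w → distance w (PC.transpose u u′ w)) (allFin m))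
        ≡⟨ sumℚ-allFin (λ w → distance w (PC.transpose u u′ w)) ⟩
      ℚΣ.sum (λ w → distance w (PC.transpose u u′ w))
        ≤⟨ ℚΣ.sum-transpose-≤ distance crossing-users-distinct (dist-uncross (tree I) crossed) ⟩
      ℚΣ.sum (λ w → distance w w)
        ≡⟨ sumℚ-allFin (λ w → distance w w) ⟨
      sumℚ (map (λ w → distance w w) (allFin m))
        ∎)
      where
      open ℚᵖ.≤-Reasoning
      distance : Fin m → Fin m → ℚ
      distance w v = dist (tree I) (user I w) (loc I (assign S v))

    uncrossed-hops : totalHops uncrossed < totalHops S
    uncrossed-hops = sum-transpose-< (λ w v → hops (tree I) (user I w) (loc I (assign S v)))
                       crossing-users-distinct (hops-uncross (tree I) crossed)

  uncross-all : ∀ S → Acc _<_ (totalHops S) → Optimal I S →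
                Σ (Solution m k) (λ S′ → Optimal I S′ × Unidirectional I S′)
  uncross-all S (acc smaller) S-optimal with crossing? S
  ... | no ¬crossing = S , S-optimal , λ e u u′ u↑ u′↓ → ¬crossing (e , u , u′ , u↑ , u′↓)
  ... | yes (e , u , u′ , u↑ , u′↓) =
    uncross-all (uncrossed S crossed) (smaller (uncrossed-hops S crossed))
      (optimal-≤ S-optimal (uncrossed-feasible S crossed (proj₁ S-optimal)) (uncrossed-cost S crossed))
    where crossed = opposite u↑ u′↓

mainTheorem6 : ∀ {n m k : ℕ} (I : Instance n m k) →
    Σ (Solution m k) (Optimal I) →
    Σ (Solution m k) (λ S → Optimal I S × Unidirectional I S)
mainTheorem6 I (S , S-optimal) = uncross-all I S (<-wellFounded _) S-optimal
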